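{- Let $m,n,p\in\mathbb N^+$ and $G=(V,E)$ a graph. Let $A,B\subseteq V$ be disjoint such that $|N(u)\cap B|\ge p$ for every $u\in A$. If $|A|>(m-1)(n-1)^p$, then (i) there are $m$ vertices $u_1,\dots,u_m$ in $A$ and $p$ vertices $v_1,\dots,v_p$ in $B$ with $\{u_i,v_j\}\in E$ for all $i\in[m]$, $j\in[p]$, or (ii) there are $n$ vertices $u_1,\dots,u_n$ in $A$ and $n$ vertices $v_1,\dots,v_n$ in $B$ such that for all $i,j\in[n]$, $\{u_i,v_j\}\in E$ iff $i=j$.
   Context: Graphs are simple and finite. $N(u)$ is the set of neighbours of $u$ in $G$. -}

module Defs where

open import Data.Nat using (ℕ)
open import Data.Fin using (Fin)
open import Data.Fin.Subset using (Subset; _∈_; _∩_; ∣_∣; Empty)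
open import Data.Vec using (tabulate)
open import Data.Bool using (Bool)
open import Relation.Nullary using (¬_)
open import Relation.Nullary.Decidable using (does)
open import Relation.Binary using (Decidable; Symmetric; Irreflexive)
open import Relation.Binary.PropositionalEquality using (_≡_)
open import Function.Definitions using (Injective)
open import Level using (0ℓ)

record Graph (k : ℕ) : Set₁ where
  field
    Adj     : Fin k → Fin k → Set
    adj?    : Decidable Adj
    sym     : Symmetric Adj
    irrefl  : Irreflexive _≡_ Adj

N : ∀ {k} (G : Graph k) → Fin k → Subset k
N G u = tabulate (λ v → does (Graph.adj? G u v))

Disjoint : ∀ {k} → Subset k → Subset k → Set
Disjoint A B = Empty (A ∩ B)

record DistinctIn {k} (n : ℕ) (S : Subset k) : Set where
  field
    pt     : Fin n → Fin k
    inj    : Injective _≡_ _≡_ pt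
    inside : ∀ i → pt i ∈ S

-- Induction on p. If some v ∈ B has more than (m-1)(n-1)^(p-1) neighbours in A,
-- recurse on A ∩ N(v) and B - v, and a biclique found there extends by v.
-- Otherwise every vertex of B has at most Δ = (m-1)(n-1)^(p-1) neighbours in A,
-- while |A| > (n-1)Δ. An induced matching of size n is then built greedily: take
-- u ∈ A with fewest neighbours in B and a neighbour v ∈ B of u, discard N(v) from A
-- and N(u) from B. This costs at most Δ vertices of A, and by the minimality of u
-- every remaining vertex of A still has a neighbour in what is left of B.
module Submission where

open import Defs
open import Data.Nat using (ℕ; zero; suc; _+_; _*_; _∸_; _^_; _≤_; _<_; z≤n; s≤s; _<?_)
open import Data.Nat.Properties hiding (suc-injective)
open import Data.Fin using (Fin; zero; suc)
open import Data.Fin.Properties using (any?; suc-injective)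
open import Data.Fin.Subset hiding (inside; outside)
open import Data.Fin.Subset.Properties
open import Data.Vec using ([]; _∷_; here; there)
open import Data.Vec.Properties using ([]=⇒lookup; lookup⇒[]=; lookup∘tabulate)
import Data.Vec.Functional as Vector
open import Data.Bool using (true; false)
open import Data.Product using (Σ; ∃; _×_; _,_)
open import Data.Sum using (_⊎_; inj₁; inj₂)
import Data.Sum as Sum
open import Relation.Nullary using (Dec; yes; no; does; contradiction)
open import Relation.Nullary.Decidable using (_×-dec_)
open import Relation.Binary.PropositionalEquality
open import Function using (_∘_)
open import Function.Bundles using (_⇔_; mk⇔; Equivalence)
open import Function.Definitions using (Injective)

x∈p─q⇒x∉q : ∀ {n} {x : Fin n} (p q : Subset n) → x ∈ p ─ q → x ∉ q
x∈p─q⇒x∉q (true ∷ p) (false ∷ q) here = λ ()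
x∈p─q⇒x∉q (_ ∷ p) (_ ∷ q) (there x∈p─q) (there x∈q) = x∈p─q⇒x∉q p q x∈p─q x∈q

∣p∣≡∣p─q∣+∣p∩q∣ : ∀ {n} (p q : Subset n) → ∣ p ∣ ≡ ∣ p ─ q ∣ + ∣ p ∩ q ∣
∣p∣≡∣p─q∣+∣p∩q∣ [] [] = refl
∣p∣≡∣p─q∣+∣p∩q∣ (true ∷ p) (true ∷ q) = trans (cong suc (∣p∣≡∣p─q∣+∣p∩q∣ p q)) (sym (+-suc _ _))
∣p∣≡∣p─q∣+∣p∩q∣ (true ∷ p) (false ∷ q) = cong suc (∣p∣≡∣p─q∣+∣p∩q∣ p q)
∣p∣≡∣p─q∣+∣p∩q∣ (false ∷ p) (true ∷ q) = ∣p∣≡∣p─q∣+∣p∩q∣ p q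
∣p∣≡∣p─q∣+∣p∩q∣ (false ∷ p) (false ∷ q) = ∣p∣≡∣p─q∣+∣p∩q∣ p q

∣p∣≤1+∣p-x∣ : ∀ {n} (p : Subset n) (x : Fin n) → ∣ p ∣ ≤ suc ∣ p - x ∣
∣p∣≤1+∣p-x∣ p x = begin
  ∣ p ∣                      ≡⟨ ∣p∣≡∣p─q∣+∣p∩q∣ p ⁅ x ⁆ ⟩
  ∣ p - x ∣ + ∣ p ∩ ⁅ x ⁆ ∣  ≤⟨ +-monoʳ-≤ ∣ p - x ∣ (∣p∩q∣≤∣q∣ p ⁅ x ⁆) ⟩
  ∣ p - x ∣ + ∣ ⁅ x ⁆ ∣      ≡⟨ cong (∣ p - x ∣ +_) (∣⁅x⁆∣≡1 x) ⟩
  ∣ p - x ∣ + 1              ≡⟨ +-comm ∣ p - x ∣ 1 ⟩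
  suc ∣ p - x ∣              ∎
  where open ≤-Reasoning

p∩q-x⊆p∩[q-x] : ∀ {n} (p q : Subset n) (x : Fin n) → (p ∩ q) - x ⊆ p ∩ (q - x)
p∩q-x⊆p∩[q-x] p q x y∈ = x∈p∩q⁺
  (p∩q⊆p p q y∈p∩q , x∈p∧x∉q⇒x∈p─q (p∩q⊆q p q y∈p∩q) (x∈p─q⇒x∉q (p ∩ q) ⁅ x ⁆ y∈))
  where y∈p∩q = p─q⊆p (p ∩ q) ⁅ x ⁆ y∈

0<∣p∣⇒Nonempty : ∀ {n} (p : Subset n) → 0 < ∣ p ∣ → Nonempty p
0<∣p∣⇒Nonempty {n} p 0<∣p∣ with nonempty? p
... | yes p≢∅ = p≢∅
... | no p≡∅ = contradiction (trans (cong ∣_∣ (Empty-unique p≡∅)) (∣⊥∣≡0 n)) (>⇒≢ 0<∣p∣)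

p∩[q─r]≡∅⇒p∩q⊆r∩q : ∀ {n} (p q r : Subset n) → Empty (p ∩ (q ─ r)) → p ∩ q ⊆ r ∩ q
p∩[q─r]≡∅⇒p∩q⊆r∩q p q r p∩[q─r]≡∅ {x} x∈p∩q with x ∈? r
... | yes x∈r = x∈p∩q⁺ (x∈r , p∩q⊆q p q x∈p∩q)
... | no x∉r = contradiction
  (x , x∈p∩q⁺ (p∩q⊆p p q x∈p∩q , x∈p∧x∉q⇒x∈p─q (p∩q⊆q p q x∈p∩q) x∉r)) p∩[q─r]≡∅

argmin : ∀ {k} (f : Fin k → ℕ) {A : Subset k} → Nonempty A →
         ∃ λ u → u ∈ A × (∀ w → w ∈ A → f u ≤ f w)
argmin f {A} (u , u∈A) = descend (f u) u u∈A ≤-refl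
  where
  descend : ∀ bound u → u ∈ A → f u ≤ bound → ∃ λ u → u ∈ A × (∀ w → w ∈ A → f u ≤ f w)
  descend zero u u∈A fu≤0 = u , u∈A , λ w _ → ≤-trans fu≤0 z≤n
  descend (suc bound) u u∈A fu≤b with any? (λ w → (w ∈? A) ×-dec (f w <? f u))
  ... | yes (w , w∈A , fw<fu) = descend bound w w∈A (≤-pred (≤-trans fw<fu fu≤b))
  ... | no noneSmaller = u , u∈A , λ w w∈A → ≮⇒≥ (λ fw<fu → noneSmaller (w , w∈A , fw<fu))

module _ {k : ℕ} where

  distinctIn-[] : {S : Subset k} → DistinctIn 0 S
  distinctIn-[] = record { pt = λ () ; inj = λ { {()} } ; inside = λ () }

  distinctIn-mono : ∀ {n} {S T : Subset k} → S ⊆ T → DistinctIn n S → DistinctIn n T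
  distinctIn-mono S⊆T D = record { pt = pt ; inj = inj ; inside = S⊆T ∘ inside }
    where open DistinctIn D

  distinctIn-∷ : ∀ {n x} {S T : Subset k} → x ∈ S → x ∈ T → DistinctIn n (S ─ T) →
                 DistinctIn (suc n) S
  distinctIn-∷ {x = x} {S} {T} x∈S x∈T D =
    record { pt = x Vector.∷ pt ; inj = inj′ ; inside = inside′ }
    where
    open DistinctIn D
    pt∉T : ∀ i → pt i ∉ T
    pt∉T i = x∈p─q⇒x∉q S T (inside i)
    inj′ : Injective _≡_ _≡_ (x Vector.∷ pt)
    inj′ {zero}  {zero}  _       = refl
    inj′ {zero}  {suc j} x≡ptj   = contradiction (subst (_∈ T) x≡ptj x∈T) (pt∉T j)
    inj′ {suc i} {zero}  pti≡x   = contradiction (subst (_∈ T) (sym pti≡x) x∈T) (pt∉T i)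
    inj′ {suc i} {suc j} pti≡ptj = cong suc (inj pti≡ptj)
    inside′ : ∀ i → (x Vector.∷ pt) i ∈ S
    inside′ zero    = x∈S
    inside′ (suc i) = p─q⊆p S T (inside i)

  distinctIn-fromCard : ∀ m (S : Subset k) → m ≤ ∣ S ∣ → DistinctIn m S
  distinctIn-fromCard zero S _ = distinctIn-[]
  distinctIn-fromCard (suc m) S m<∣S∣ with 0<∣p∣⇒Nonempty S (≤-trans (s≤s z≤n) m<∣S∣)
  ... | x , x∈S = distinctIn-∷ x∈S (x∈⁅x⁆ x)
        (distinctIn-fromCard m (S - x) (≤-pred (≤-trans m<∣S∣ (∣p∣≤1+∣p-x∣ S x))))

module _ {k : ℕ} (G : Graph k) where
  open Graph G using (Adj; adj?) renaming (sym to Adj-sym)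

  ∈N⇒Adj : ∀ {u x} → x ∈ N G u → Adj u x
  ∈N⇒Adj {u} {x} x∈N[u]
    with adj? u x | trans (sym (lookup∘tabulate (does ∘ adj? u) x)) ([]=⇒lookup x∈N[u])
  ... | yes u~x | _ = u~x
  ... | no _    | ()

  Adj⇒∈N : ∀ {u x} → Adj u x → x ∈ N G u
  Adj⇒∈N {u} {x} u~x = lookup⇒[]= x (N G u)
    (trans (lookup∘tabulate (does ∘ adj? u) x) (does-yes (adj? u x)))
    where
    does-yes : (d : Dec (Adj u x)) → does d ≡ true
    does-yes (yes _) = refl
    does-yes (no ¬u~x) = contradiction u~x ¬u~x

  Biclique : ℕ → ℕ → Subset k → Subset k → Set
  Biclique m p A B = Σ (DistinctIn m A) λ U → Σ (DistinctIn p B) λ W →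
    ∀ (i : Fin m) (j : Fin p) → Adj (DistinctIn.pt U i) (DistinctIn.pt W j)

  InducedMatching : ℕ → Subset k → Subset k → Set
  InducedMatching n A B = Σ (DistinctIn n A) λ U → Σ (DistinctIn n B) λ W →
    ∀ (i j : Fin n) → Adj (DistinctIn.pt U i) (DistinctIn.pt W j) ⇔ (i ≡ j)

  biclique-∷ : ∀ {m p v} {A B : Subset k} → v ∈ B →
               Biclique m p (N G v ∩ A) (B - v) → Biclique m (suc p) A B
  biclique-∷ {v = v} {A} v∈B (U , W , complete) =
    distinctIn-mono (p∩q⊆q (N G v) A) U , distinctIn-∷ v∈B (x∈⁅x⁆ v) W , complete′
    where
    open DistinctIn
    complete′ : ∀ i j → Adj (pt U i) ((v Vector.∷ pt W) j)
    complete′ i zero    = Adj-sym (∈N⇒Adj (p∩q⊆p (N G v) A (inside U i)))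
    complete′ i (suc j) = complete i j

  inducedMatching-mono : ∀ {n} {A A′ B B′ : Subset k} → A ⊆ A′ → B ⊆ B′ →
                         InducedMatching n A B → InducedMatching n A′ B′
  inducedMatching-mono A⊆A′ B⊆B′ (U , W , matched) =
    distinctIn-mono A⊆A′ U , distinctIn-mono B⊆B′ W , matched

  inducedMatching-∷ : ∀ {n u v} {A B : Subset k} → u ∈ A → v ∈ B → Adj u v →
                      InducedMatching n (A ─ N G v) (B ─ N G u) → InducedMatching (suc n) A B
  inducedMatching-∷ {u = u} {v} {A} {B} u∈A v∈B u~v (U , W , matched) =
    distinctIn-∷ u∈A (Adj⇒∈N (Adj-sym u~v)) U , distinctIn-∷ v∈B (Adj⇒∈N u~v) W , matched′
    where
    open DistinctIn
    matched′ : ∀ i j → Adj ((u Vector.∷ pt U) i) ((v Vector.∷ pt W) j) ⇔ (i ≡ j)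
    matched′ zero zero = mk⇔ (λ _ → refl) (λ _ → u~v)
    matched′ zero (suc j) =
      mk⇔ (λ u~w → contradiction (Adj⇒∈N u~w) (x∈p─q⇒x∉q B (N G u) (inside W j))) λ ()
    matched′ (suc i) zero =
      mk⇔ (λ w~v → contradiction (Adj⇒∈N (Adj-sym w~v)) (x∈p─q⇒x∉q A (N G v) (inside U i))) λ ()
    matched′ (suc i) (suc j) =
      mk⇔ (cong suc ∘ Equivalence.to (matched i j)) (Equivalence.from (matched i j) ∘ suc-injective)

  inducedMatching-ofBoundedDegree : ∀ n Δ (A B : Subset k) →
    (∀ v → v ∈ B → ∣ N G v ∩ A ∣ ≤ Δ) →
    (∀ u → u ∈ A → Nonempty (N G u ∩ B)) →
    n * Δ < ∣ A ∣ → InducedMatching (suc n) A B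
  inducedMatching-ofBoundedDegree n Δ A B degB degA n*Δ<∣A∣
    with argmin (λ w → ∣ N G w ∩ B ∣) (0<∣p∣⇒Nonempty A (≤-trans (s≤s z≤n) n*Δ<∣A∣))
  ... | u , u∈A , u-minimal with degA u u∈A
  ... | v , v∈N[u]∩B = inducedMatching-∷ u∈A v∈B u~v (remaining n n*Δ<∣A∣)
    where
    v∈B : v ∈ B
    v∈B = p∩q⊆q (N G u) B v∈N[u]∩B
    u~v : Adj u v
    u~v = ∈N⇒Adj (p∩q⊆p (N G u) B v∈N[u]∩B)
    A′ B′ : Subset k
    A′ = A ─ N G v
    B′ = B ─ N G u

    degB′ : ∀ x → x ∈ B′ → ∣ N G x ∩ A′ ∣ ≤ Δ
    degB′ x x∈B′ = ≤-trans
      (p⊆q⇒∣p∣≤∣q∣ λ y∈ → x∈p∩q⁺ (p∩q⊆p (N G x) A′ y∈ , p─q⊆p A (N G v) (p∩q⊆q (N G x) A′ y∈)))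
      (degB x (p─q⊆p B (N G u) x∈B′))

    -- If w ∈ A′ had no neighbour in B′, then N(w) ∩ B ⊆ N(u) ∩ B, and the inclusion
    -- is strict because v ∉ N(w); this contradicts the minimality of u.
    degA′ : ∀ w → w ∈ A′ → Nonempty (N G w ∩ B′)
    degA′ w w∈A′ with nonempty? (N G w ∩ B′)
    ... | yes w-hasNeighbour = w-hasNeighbour
    ... | no w-isolated = contradiction (u-minimal w (p─q⊆p A (N G v) w∈A′))
          (<⇒≱ (p⊂q⇒∣p∣<∣q∣ (p∩[q─r]≡∅⇒p∩q⊆r∩q (N G w) B (N G u) w-isolated ,
                              v , v∈N[u]∩B , v∉N[w]∩B)))
      where
      v∉N[w]∩B : v ∉ N G w ∩ B
      v∉N[w]∩B v∈N[w]∩B = x∈p─q⇒x∉q A (N G v) w∈A′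
        (Adj⇒∈N (Adj-sym (∈N⇒Adj (p∩q⊆p (N G w) B v∈N[w]∩B))))

    ∣A′∣-bound : ∀ m → suc m * Δ < ∣ A ∣ → m * Δ < ∣ A′ ∣
    ∣A′∣-bound m bound = +-cancelˡ-< Δ (m * Δ) ∣ A′ ∣ (begin-strict
      Δ + m * Δ                 <⟨ bound ⟩
      ∣ A ∣                     ≡⟨ ∣p∣≡∣p─q∣+∣p∩q∣ A (N G v) ⟩
      ∣ A′ ∣ + ∣ A ∩ N G v ∣    ≡⟨ cong (λ S → ∣ A′ ∣ + ∣ S ∣) (∩-comm A (N G v)) ⟩
      ∣ A′ ∣ + ∣ N G v ∩ A ∣    ≤⟨ +-monoʳ-≤ ∣ A′ ∣ (degB v v∈B) ⟩
      ∣ A′ ∣ + Δ                ≡⟨ +-comm ∣ A′ ∣ Δ ⟩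
      Δ + ∣ A′ ∣                ∎)
      where open ≤-Reasoning

    remaining : ∀ m → m * Δ < ∣ A ∣ → InducedMatching m A′ B′
    remaining zero    _     = distinctIn-[] , distinctIn-[] , λ ()
    remaining (suc m) bound =
      inducedMatching-ofBoundedDegree m Δ A′ B′ degB′ degA′ (∣A′∣-bound m bound)

  bicliqueOrInducedMatching : ∀ m n p → 1 ≤ m → (A B : Subset k) →
    (∀ u → u ∈ A → p ≤ ∣ N G u ∩ B ∣) →
    (m ∸ 1) * (n ∸ 1) ^ p < ∣ A ∣ → Biclique m p A B ⊎ InducedMatching n A B
  bicliqueOrInducedMatching (suc m) n zero _ A B _ m*1<∣A∣ =
    inj₁ (distinctIn-fromCard (suc m) A (subst (_< ∣ A ∣) (*-identityʳ m) m*1<∣A∣) ,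
          distinctIn-[] , λ _ ())
  bicliqueOrInducedMatching m n (suc p) 1≤m A B degA bound
    with any? (λ v → (v ∈? B) ×-dec ((m ∸ 1) * (n ∸ 1) ^ p <? ∣ N G v ∩ A ∣))
  ... | yes (v , v∈B , v-rich) =
    Sum.map (biclique-∷ v∈B) (inducedMatching-mono (p∩q⊆q (N G v) A) (p─q⊆p B ⁅ v ⁆))
      (bicliqueOrInducedMatching m n p 1≤m (N G v ∩ A) (B - v) degA′ v-rich)
    where
    degA′ : ∀ u → u ∈ N G v ∩ A → p ≤ ∣ N G u ∩ (B - v) ∣
    degA′ u u∈ = ≤-pred (begin
      suc p                        ≤⟨ degA u (p∩q⊆q (N G v) A u∈) ⟩
      ∣ N G u ∩ B ∣                ≤⟨ ∣p∣≤1+∣p-x∣ (N G u ∩ B) v ⟩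
      suc ∣ (N G u ∩ B) - v ∣      ≤⟨ s≤s (p⊆q⇒∣p∣≤∣q∣ (p∩q-x⊆p∩[q-x] (N G u) B v)) ⟩
      suc ∣ N G u ∩ (B - v) ∣      ∎)
      where open ≤-Reasoning
  ... | no noneRich with n
  ...   | zero = inj₂ (distinctIn-[] , distinctIn-[] , λ ())
  ...   | suc n′ = inj₂ (inducedMatching-ofBoundedDegree n′ Δ A B lowDegree hasNeighbour
                                                          (subst (_< ∣ A ∣) reassoc bound))
    where
    Δ : ℕ
    Δ = (m ∸ 1) * n′ ^ p
    lowDegree : ∀ v → v ∈ B → ∣ N G v ∩ A ∣ ≤ Δ
    lowDegree v v∈B = ≮⇒≥ λ v-rich → noneRich (v , v∈B , v-rich)
    hasNeighbour : ∀ u → u ∈ A → Nonempty (N G u ∩ B)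
    hasNeighbour u u∈A = 0<∣p∣⇒Nonempty (N G u ∩ B) (≤-trans (s≤s z≤n) (degA u u∈A))
    reassoc : (m ∸ 1) * (n′ * n′ ^ p) ≡ n′ * Δ
    reassoc = begin
      (m ∸ 1) * (n′ * n′ ^ p)  ≡⟨ *-assoc (m ∸ 1) n′ (n′ ^ p) ⟨
      (m ∸ 1) * n′ * n′ ^ p    ≡⟨ cong (_* n′ ^ p) (*-comm (m ∸ 1) n′) ⟩
      n′ * (m ∸ 1) * n′ ^ p    ≡⟨ *-assoc n′ (m ∸ 1) (n′ ^ p) ⟩
      n′ * Δ                   ∎
      where open ≡-Reasoning

lemma3p14 : (m n p k : ℕ) → 1 ≤ m → 1 ≤ n → 1 ≤ p →
    (G : Graph k) (A B : Subset k) → Disjoint A B →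
    (∀ u → u ∈ A → p ≤ ∣ N G u ∩ B ∣) →
    (m ∸ 1) * (n ∸ 1) ^ p < ∣ A ∣ →
    (Σ (DistinctIn m A) λ U → Σ (DistinctIn p B) λ W →
        ∀ (i : Fin m) (j : Fin p) →
          Graph.Adj G (DistinctIn.pt U i) (DistinctIn.pt W j))
    ⊎
    (Σ (DistinctIn n A) λ U → Σ (DistinctIn n B) λ W →
        ∀ (i j : Fin n) →
          Graph.Adj G (DistinctIn.pt U i) (DistinctIn.pt W j) ⇔ (i ≡ j))
lemma3p14 m n p k 1≤m _ _ G A B _ = bicliqueOrInducedMatching G m n p 1≤m A B
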